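{- Let $\xi_1,\xi_2,\dots$ and $\xi_1',\xi_2',\dots$ be independent Rademacher random variables, and for integers $0\le m\le n$ with $n$ even define \[\alpha(n,m)=\frac{\Pr[\xi_1+\cdots+\xi_n=0 \text{ and } \xi_1+\cdots+\xi_m+\xi_{m+1}'+\cdots+\xi_n'=0]}{\Pr[\xi_1+\cdots+\xi_n=0]^2}.\] Then for $\varepsilon\in(0,1)$, $n$ even and $0\le m\le(1-\varepsilon)n$, we have $\alpha(n,m)=1+O(m/(\varepsilon n))$, where the implied constant is absolute.
   Context: A Rademacher random variable is uniform on $\{ -1,+1\}$.
   Formalization: The parameter ε takes only rational values in the interval (0,1). -}

module Defs where

open import Data.Bool using (Bool; true; false)
open import Data.Nat as ℕ using (ℕ; zero; suc; _<ᵇ_)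
open import Data.Integer as ℤ using (ℤ; +_)
open import Data.Fin using (Fin; toℕ)
open import Data.Vec as Vec using (Vec; []; _∷_; lookup)
open import Data.List as List using (List; _++_; length; filter; cartesianProduct)
open import Data.Product using (_×_; _,_)
open import Data.Rational as ℚ using (ℚ; 0ℚ; 1ℚ; _÷_; _/_)
open import Relation.Nullary using (yes; no)
open import Relation.Binary.PropositionalEquality using (_≡_)

toℚ : ℕ → ℚ
toℚ n = + n / 1

sign : Bool → ℤ
sign true  = + 1
sign false = ℤ.- (+ 1)

-- all 2^n sign patterns (the uniform sample space of n independent Rademachers)
allVec : ∀ n → List (Vec Bool n)
allVec zero    = [] List.∷ List.[]
allVec (suc n) = List.map (true ∷_) (allVec n) ++ List.map (false ∷_) (allVec n)

S : ∀ {n} → Vec Bool n → ℤ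
S []       = + 0
S (b ∷ bs) = sign b ℤ.+ S bs

mixS : ∀ {n} → ℕ → Vec Bool n → Vec Bool n → ℤ
mixS m []       []         = + 0
mixS zero (b ∷ bs) (b' ∷ bs') = sign b' ℤ.+ mixS zero bs bs'
mixS (suc m) (b ∷ bs) (b' ∷ bs') = sign b ℤ.+ mixS m bs bs'

halfPow : ℕ → ℚ
halfPow zero    = 1ℚ
halfPow (suc k) = (+ 1 / 2) ℚ.* halfPow k

P₁ : ℕ → ℚ
P₁ n = toℚ (length (filter (λ v → S v ℤ.≟ + 0) (allVec n))) ℚ.* halfPow n

jointEvent : ∀ {n} → ℕ → Vec Bool n × Vec Bool n → Set
jointEvent m (x , x') = (S x ≡ + 0) × (mixS m x x' ≡ + 0)

P₂ : ℕ → ℕ → ℚ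
P₂ n m = toℚ (length (filter dec (cartesianProduct (allVec n) (allVec n))))
         ℚ.* halfPow (n ℕ.+ n)
  where
  dec : (p : Vec Bool n × Vec Bool n) → _
  dec (x , x') with S x ℤ.≟ + 0 | mixS m x x' ℤ.≟ + 0
  ... | yes a | yes b = yes (a , b)
  ... | no a  | _     = no (λ { (p , _) → a p })
  ... | yes _ | no b  = no (λ { (_ , q) → b q })

-- α(n,m) = P₂ / P₁²  (junk value 0 if the denominator vanishes; it never does for even n)
α : ℕ → ℕ → ℚ
α n m with P₁ n ℚ.* P₁ n ℚ.≟ 0ℚ
... | yes _  = 0ℚ
... | no neq = _÷_ (P₂ n m) (P₁ n ℚ.* P₁ n) {{ℚ.≢-nonZero neq}}

module Submission where

-- Split ξ = (u, w) into its first m and last k = n − m signs, and let F(c) count the w ∈ {±1}ᵏ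
-- with c + Σw = 0. Then 2ⁿ·Pr[Σξ = 0] = Σᵤ F(Σu) and, as ξ and ξ′ share u,
-- 4ⁿ·Pr[both sums vanish] = 2ᵐ Σᵤ F(Σu)², so α(n,m) = 2ᵐ Σᵤ F(Σu)² / (Σᵤ F(Σu))².
-- Cauchy–Schwarz gives α ≥ 1. By unimodality F ≤ C(k,⌊k/2⌋), and j ↦ j·C(j,⌊j/2⌋)/2ʲ is
-- nondecreasing, so k·2ᵐ·C(k,⌊k/2⌋) ≤ n·C(n,n/2) = n·Σᵤ F(Σu); together α ≤ n/k.
-- As k ≥ εn, this gives 0 ≤ α − 1 ≤ m/k ≤ m/(εn), i.e. the constant 1 works.

module Binomial where

  open import Data.Nat
  open import Data.Nat.Properties
  open import Data.Nat.Combinatorics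
  open import Data.Nat.Tactic.RingSolver using (solve-∀)
  open import Algebra.Properties.CommutativeSemigroup *-commutativeSemigroup using (x∙yz≈y∙xz)
  open import Function using (_∘_)
  open import Relation.Nullary using (yes; no)
  open import Relation.Binary.PropositionalEquality

  -- (k + 1) C(n, k + 1) = (n − k) C(n, k), with k C(n, k) moved across to avoid truncated subtraction.
  [k+1]*nC[k+1]+k*nCk≡n*nCk : ∀ n k → suc k * (n C suc k) + k * (n C k) ≡ n * (n C k)
  [k+1]*nC[k+1]+k*nCk≡n*nCk zero    zero    = refl
  [k+1]*nC[k+1]+k*nCk≡n*nCk zero    (suc k) = cong₂ _+_ (*-zeroʳ (suc (suc k))) (*-zeroʳ (suc k))
  [k+1]*nC[k+1]+k*nCk≡n*nCk (suc n) zero    =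
    trans (+-identityʳ _) (trans (+-identityʳ _) (trans (nC1≡n (suc n)) (sym (*-identityʳ (suc n)))))
  [k+1]*nC[k+1]+k*nCk≡n*nCk (suc n) (suc k) = begin
    suc (suc k) * (suc n C suc (suc k)) + suc k * (suc n C suc k)
      ≡⟨ cong₂ (λ x y → suc (suc k) * x + suc k * y)
               (nCk+nC[k+1]≡[n+1]C[k+1] n (suc k)) (nCk+nC[k+1]≡[n+1]C[k+1] n k) ⟨
    suc (suc k) * (b + c) + suc k * (a + b)
      ≡⟨ regroup k a b c ⟩
    (suc (suc k) * c + suc k * b) + (suc k * b + k * a) + (a + b)
      ≡⟨ cong₂ (λ x y → x + y + (a + b))
               ([k+1]*nC[k+1]+k*nCk≡n*nCk n (suc k)) ([k+1]*nC[k+1]+k*nCk≡n*nCk n k) ⟩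
    n * b + n * a + (a + b)
      ≡⟨ collect n a b ⟩
    suc n * (a + b)
      ≡⟨ cong (suc n *_) (nCk+nC[k+1]≡[n+1]C[k+1] n k) ⟩
    suc n * (suc n C suc k) ∎
    where
    open ≡-Reasoning
    a b c : ℕ
    a = n C k
    b = n C suc k
    c = n C suc (suc k)
    regroup : ∀ k a b c → suc (suc k) * (b + c) + suc k * (a + b)
                        ≡ (suc (suc k) * c + suc k * b) + (suc k * b + k * a) + (a + b)
    regroup = solve-∀
    collect : ∀ n a b → n * b + n * a + (a + b) ≡ suc n * (a + b)
    collect = solve-∀

  [k+1]*[n+1]C[k+1]≡[n+1]*nCk : ∀ n k → suc k * (suc n C suc k) ≡ suc n * (n C k)
  [k+1]*[n+1]C[k+1]≡[n+1]*nCk n k = +-cancelʳ-≡ (k * a) _ _ (begin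
    suc k * (suc n C suc k) + k * a ≡⟨ cong (λ x → suc k * x + k * a) (nCk+nC[k+1]≡[n+1]C[k+1] n k) ⟨
    suc k * (a + b) + k * a         ≡⟨ expand k a b ⟩
    suc k * a + (suc k * b + k * a) ≡⟨ cong (suc k * a +_) ([k+1]*nC[k+1]+k*nCk≡n*nCk n k) ⟩
    suc k * a + n * a               ≡⟨ swap k n a ⟩
    suc n * a + k * a               ∎)
    where
    open ≡-Reasoning
    a b : ℕ
    a = n C k
    b = n C suc k
    expand : ∀ k a b → suc k * (a + b) + k * a ≡ suc k * a + (suc k * b + k * a)
    expand = solve-∀
    swap : ∀ k n a → suc k * a + n * a ≡ suc n * a + k * a
    swap = solve-∀

  k≤n⇒0<nCk : ∀ {n k} → k ≤ n → 0 < n C k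
  k≤n⇒0<nCk {k = zero} _ = z<s
  k≤n⇒0<nCk {suc n} {suc k} (s≤s k≤n) =
    ≤-trans (k≤n⇒0<nCk k≤n) (≤-trans (m≤m+n _ _) (≤-reflexive (nCk+nC[k+1]≡[n+1]C[k+1] n k)))

  2k<n⇒nCk≤nC[k+1] : ∀ {n k} → suc (k + k) ≤ n → n C k ≤ n C suc k
  2k<n⇒nCk≤nC[k+1] {n} {k} 2k<n = *-cancelˡ-≤ (suc k) (+-cancelʳ-≤ (k * (n C k)) _ _ (begin
    suc k * (n C k) + k * (n C k)     ≡⟨ *-distribʳ-+ (n C k) (suc k) k ⟨
    suc (k + k) * (n C k)             ≤⟨ *-monoˡ-≤ (n C k) 2k<n ⟩
    n * (n C k)                       ≡⟨ [k+1]*nC[k+1]+k*nCk≡n*nCk n k ⟨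
    suc k * (n C suc k) + k * (n C k) ∎))
    where open ≤-Reasoning

  n≤2k+1⇒nC[k+1]≤nCk : ∀ {n k} → n ≤ suc (k + k) → n C suc k ≤ n C k
  n≤2k+1⇒nC[k+1]≤nCk {n} {k} n≤2k+1 = *-cancelˡ-≤ (suc k) (+-cancelʳ-≤ (k * (n C k)) _ _ (begin
    suc k * (n C suc k) + k * (n C k) ≡⟨ [k+1]*nC[k+1]+k*nCk≡n*nCk n k ⟩
    n * (n C k)                       ≤⟨ *-monoˡ-≤ (n C k) n≤2k+1 ⟩
    suc (k + k) * (n C k)             ≡⟨ *-distribʳ-+ (n C k) (suc k) k ⟩
    suc k * (n C k) + k * (n C k)     ∎))
    where open ≤-Reasoning

  C-monoʳ-≤-below-half : ∀ {n i j} → i ≤ j → j + j ≤ n → n C i ≤ n C j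
  C-monoʳ-≤-below-half i≤j = go (≤⇒≤′ i≤j)
    where
    go : ∀ {n i j} → i ≤′ j → j + j ≤ n → n C i ≤ n C j
    go (≤′-reflexive refl) _ = ≤-refl
    go {n} {j = suc j} (≤′-step i≤′j) 2j+2≤n =
      ≤-trans (go i≤′j (≤-trans (n≤1+n _) 2j+1≤n)) (2k<n⇒nCk≤nC[k+1] 2j+1≤n)
      where
      2j+1≤n : suc (j + j) ≤ n
      2j+1≤n = ≤-trans (s≤s (+-monoʳ-≤ j (n≤1+n j))) 2j+2≤n

  C-antimonoʳ-≤-above-half : ∀ {n i j} → i ≤ j → n ≤ suc (i + i) → n C j ≤ n C i
  C-antimonoʳ-≤-above-half i≤j = go (≤⇒≤′ i≤j)
    where
    go : ∀ {n i j} → i ≤′ j → n ≤ suc (i + i) → n C j ≤ n C i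
    go (≤′-reflexive refl) _ = ≤-refl
    go {n} {i} {suc j} (≤′-step i≤′j) n≤2i+1 =
      ≤-trans (n≤2k+1⇒nC[k+1]≤nCk (≤-trans n≤2i+1 (s≤s (+-mono-≤ (≤′⇒≤ i≤′j) (≤′⇒≤ i≤′j)))))
              (go i≤′j n≤2i+1)

  maxBinomial : ℕ → ℕ
  maxBinomial n = n C ⌊ n /2⌋

  nCk≤maxBinomial : ∀ n k → n C k ≤ maxBinomial n
  nCk≤maxBinomial n k with k ≤? ⌊ n /2⌋
  ... | yes k≤h = C-monoʳ-≤-below-half k≤h
                    (≤-trans (+-monoʳ-≤ ⌊ n /2⌋ (⌊n/2⌋≤⌈n/2⌉ n)) (≤-reflexive (⌊n/2⌋+⌈n/2⌉≡n n)))
  ... | no k≰h = C-antimonoʳ-≤-above-half (<⇒≤ (≰⇒> k≰h)) (begin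
    n                         ≡⟨ ⌊n/2⌋+⌈n/2⌉≡n n ⟨
    ⌊ n /2⌋ + ⌈ n /2⌉         ≤⟨ +-monoʳ-≤ ⌊ n /2⌋ (⌊n/2⌋-mono (n≤1+n (suc n))) ⟩
    ⌊ n /2⌋ + suc ⌊ n /2⌋     ≡⟨ +-suc ⌊ n /2⌋ ⌊ n /2⌋ ⟩
    suc (⌊ n /2⌋ + ⌊ n /2⌋)   ∎)
    where open ≤-Reasoning

  data EvenOdd : ℕ → Set where
    even : ∀ a → EvenOdd (a + a)
    odd  : ∀ a → EvenOdd (suc (a + a))

  evenOdd : ∀ n → EvenOdd n
  evenOdd zero = even 0
  evenOdd (suc zero) = odd 0
  evenOdd (suc (suc n)) with evenOdd n
  ... | even a = subst EvenOdd (cong suc (+-suc a a)) (even (suc a))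
  ... | odd a  = subst EvenOdd (cong (suc ∘ suc) (+-suc a a)) (odd (suc a))

  maxBinomial-even : ∀ a → maxBinomial (a + a) ≡ (a + a) C a
  maxBinomial-even a = cong ((a + a) C_) (sym (n≡⌊n+n/2⌋ a))

  maxBinomial-odd : ∀ a → maxBinomial (suc (a + a)) ≡ suc (a + a) C a
  maxBinomial-odd a = cong (suc (a + a) C_) (⌊1+n+n/2⌋≡n a)
    where
    ⌊1+n+n/2⌋≡n : ∀ n → ⌊ suc (n + n) /2⌋ ≡ n
    ⌊1+n+n/2⌋≡n zero = refl
    ⌊1+n+n/2⌋≡n (suc n) = cong suc (trans (cong ⌊_/2⌋ (+-suc n n)) (⌊1+n+n/2⌋≡n n))

  maxBinomial-growth : ∀ j → 2 * (j * maxBinomial j) ≤ suc j * maxBinomial (suc j)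
  maxBinomial-growth j with evenOdd j
  -- even case: (a + 1) C(2a + 1, a) = (2a + 1) C(2a, a) and 4a(a + 1) < (2a + 1)²
  ... | even a rewrite maxBinomial-even a | maxBinomial-odd a = *-cancelˡ-≤ (suc a) (begin
    suc a * (2 * ((a + a) * c))          ≤⟨ m≤m+n _ c ⟩
    suc a * (2 * ((a + a) * c)) + c      ≡⟨ square a c ⟩
    suc (a + a) * (suc (a + a) * c)      ≡⟨ cong (suc (a + a) *_) ([k+1]*[n+1]C[k+1]≡[n+1]*nCk (a + a) a) ⟨
    suc (a + a) * (suc a * (suc (a + a) C suc a)) ≡⟨ cong (λ x → suc (a + a) * (suc a * x)) middle ⟨
    suc (a + a) * (suc a * d)            ≡⟨ x∙yz≈y∙xz (suc (a + a)) (suc a) d ⟩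
    suc a * (suc (a + a) * d)            ∎)
    where
    open ≤-Reasoning
    c d : ℕ
    c = (a + a) C a
    d = suc (a + a) C a
    middle : d ≡ suc (a + a) C suc a
    middle = trans (nCk≡nC[n∸k] (m≤n+m a (suc a))) (cong (suc (a + a) C_) (m+n∸n≡m (suc a) a))
    square : ∀ a c → suc a * (2 * ((a + a) * c)) + c ≡ suc (a + a) * (suc (a + a) * c)
    square = solve-∀
  ... | odd a rewrite maxBinomial-odd a = begin
    2 * (suc (a + a) * d)                ≤⟨ m≤m+n _ (2 * d) ⟩
    2 * (suc (a + a) * d) + 2 * d        ≡⟨ expand a d ⟩
    suc (suc (a + a)) * (2 * d)          ≡⟨ cong (suc (suc (a + a)) *_) next ⟨
    suc (suc (a + a)) * maxBinomial (suc (suc (a + a))) ∎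
    where
    open ≤-Reasoning
    d : ℕ
    d = suc (a + a) C a
    expand : ∀ a d → 2 * (suc (a + a) * d) + 2 * d ≡ suc (suc (a + a)) * (2 * d)
    expand = solve-∀
    next : maxBinomial (suc (suc (a + a))) ≡ 2 * d
    next = trans (cong (λ h → suc (suc (a + a)) C suc h) (sym (n≡⌊n+n/2⌋ a)))
                 (*-cancelˡ-≡ _ _ (suc a) (trans ([k+1]*[n+1]C[k+1]≡[n+1]*nCk (suc (a + a)) a) (double a d)))
      where
      double : ∀ a d → suc (suc (a + a)) * d ≡ suc a * (2 * d)
      double = solve-∀

  maxBinomial-growth-+ : ∀ m k → 2 ^ m * (k * maxBinomial k) ≤ (m + k) * maxBinomial (m + k)
  maxBinomial-growth-+ zero k = ≤-reflexive (*-identityˡ _)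
  maxBinomial-growth-+ (suc m) k = begin
    2 * 2 ^ m * (k * maxBinomial k)          ≡⟨ *-assoc 2 (2 ^ m) _ ⟩
    2 * (2 ^ m * (k * maxBinomial k))        ≤⟨ *-monoʳ-≤ 2 (maxBinomial-growth-+ m k) ⟩
    2 * ((m + k) * maxBinomial (m + k))      ≤⟨ maxBinomial-growth (m + k) ⟩
    suc (m + k) * maxBinomial (suc (m + k))  ∎
    where open ≤-Reasoning

module Counting where

  open import Defs using (allVec)
  open import Data.Bool using (Bool; true; false; if_then_else_)
  open import Data.Nat
  open import Data.Nat.Properties
  open import Data.Nat.ListAction using (sum)
  open import Data.Nat.ListAction.Properties using (sum-++)
  open import Data.Nat.Tactic.RingSolver using (solve-∀)
  open import Data.List as List using ([]; _∷_; map; length; filter; cartesianProduct)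
  open import Data.List.Properties using (map-++; map-∘; map-cong)
  open import Data.Vec using (Vec; []; _∷_; _++_)
  open import Data.Product using (_×_; _,_; proj₁; proj₂)
  open import Data.Sum using ([_,_]′)
  open import Function using (_∘_; id)
  open import Relation.Nullary using (Dec; does; yes; no; contradiction)
  open import Relation.Unary using (Pred; Decidable)
  open import Relation.Binary.PropositionalEquality

  -- Defined through does so that, e.g., 𝟙 (suc a ≟ suc b) reduces to 𝟙 (a ≟ b).
  𝟙 : ∀ {p} {P : Set p} → Dec P → ℕ
  𝟙 P? = if does P? then 1 else 0

  𝟙-mono : ∀ {p q} {P : Set p} {Q : Set q} (P? : Dec P) (Q? : Dec Q) → (P → Q) → 𝟙 P? ≤ 𝟙 Q?
  𝟙-mono (yes p) (yes _) _   = ≤-refl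
  𝟙-mono (yes p) (no ¬q) P⇒Q with () ← ¬q (P⇒Q p)
  𝟙-mono (no _)  _       _   = z≤n

  𝟙-cong : ∀ {p q} {P : Set p} {Q : Set q} (P? : Dec P) (Q? : Dec Q) →
           (P → Q) → (Q → P) → 𝟙 P? ≡ 𝟙 Q?
  𝟙-cong P? Q? P⇒Q Q⇒P = ≤-antisym (𝟙-mono P? Q? P⇒Q) (𝟙-mono Q? P? Q⇒P)

  𝟙-× : ∀ {p q} {P : Set p} {Q : Set q} (P? : Dec P) (Q? : Dec Q) (P×Q? : Dec (P × Q)) →
        𝟙 P×Q? ≡ 𝟙 P? * 𝟙 Q?
  𝟙-× (yes p) (yes q) P×Q? = 𝟙-cong P×Q? (yes (p , q)) id id
  𝟙-× (yes _) (no ¬q) P×Q? = 𝟙-cong P×Q? (no ¬q) proj₂ (λ q → contradiction q ¬q)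
  𝟙-× (no ¬p) _       P×Q? = 𝟙-cong P×Q? (no ¬p) proj₁ (λ p → contradiction p ¬p)

  length-filter≡sum-𝟙 : ∀ {a ℓ} {A : Set a} {P : Pred A ℓ} (P? : Decidable P) xs →
                        length (filter P? xs) ≡ sum (map (𝟙 ∘ P?) xs)
  length-filter≡sum-𝟙 P? [] = refl
  length-filter≡sum-𝟙 P? (x ∷ xs) with P? x
  ... | yes _ = cong suc (length-filter≡sum-𝟙 P? xs)
  ... | no _  = length-filter≡sum-𝟙 P? xs

  sum-map-++ : ∀ {a} {A : Set a} (f : A → ℕ) xs ys → sum (map f (xs List.++ ys)) ≡ sum (map f xs) + sum (map f ys)
  sum-map-++ f xs ys = trans (cong sum (map-++ f xs ys)) (sum-++ (map f xs) (map f ys))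

  module _ {a} {A : Set a} where

    sum-map-mono : ∀ {f g : A → ℕ} → (∀ x → f x ≤ g x) → ∀ xs → sum (map f xs) ≤ sum (map g xs)
    sum-map-mono f≤g [] = z≤n
    sum-map-mono f≤g (x ∷ xs) = +-mono-≤ (f≤g x) (sum-map-mono f≤g xs)

    sum-map-*ˡ : ∀ c (f : A → ℕ) xs → sum (map (λ x → c * f x) xs) ≡ c * sum (map f xs)
    sum-map-*ˡ c f [] = sym (*-zeroʳ c)
    sum-map-*ˡ c f (x ∷ xs) =
      trans (cong (c * f x +_) (sum-map-*ˡ c f xs)) (sym (*-distribˡ-+ c (f x) _))

    sum-map-cartesianProduct : ∀ {b} {B : Set b} (f : A × B → ℕ) xs ys →
      sum (map f (cartesianProduct xs ys)) ≡ sum (map (λ x → sum (map (λ y → f (x , y)) ys)) xs)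
    sum-map-cartesianProduct f [] ys = refl
    sum-map-cartesianProduct f (x ∷ xs) ys = trans (sum-map-++ f (map (x ,_) ys) _)
      (cong₂ _+_ (cong sum (sym (map-∘ ys))) (sum-map-cartesianProduct f xs ys))

  sumOver : ∀ n → (Vec Bool n → ℕ) → ℕ
  sumOver n f = sum (map f (allVec n))

  sumOver-suc : ∀ n (f : Vec Bool (suc n) → ℕ) →
    sumOver (suc n) f ≡ sumOver n (f ∘ (true ∷_)) + sumOver n (f ∘ (false ∷_))
  sumOver-suc n f = trans (sum-map-++ f (map (true ∷_) (allVec n)) _)
    (cong₂ _+_ (cong sum (sym (map-∘ (allVec n)))) (cong sum (sym (map-∘ (allVec n)))))

  sumOver-cong : ∀ n {f g : Vec Bool n → ℕ} → (∀ x → f x ≡ g x) → sumOver n f ≡ sumOver n g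
  sumOver-cong n f≗g = cong sum (map-cong f≗g (allVec n))

  sumOver-mono : ∀ n {f g : Vec Bool n → ℕ} → (∀ x → f x ≤ g x) → sumOver n f ≤ sumOver n g
  sumOver-mono n f≤g = sum-map-mono f≤g (allVec n)

  sumOver-*ˡ : ∀ n c (f : Vec Bool n → ℕ) → sumOver n (λ x → c * f x) ≡ c * sumOver n f
  sumOver-*ˡ n c f = sum-map-*ˡ c f (allVec n)

  sumOver-*ʳ : ∀ n c (f : Vec Bool n → ℕ) → sumOver n (λ x → f x * c) ≡ sumOver n f * c
  sumOver-*ʳ n c f = begin
    sumOver n (λ x → f x * c) ≡⟨ sumOver-cong n (λ x → *-comm (f x) c) ⟩
    sumOver n (λ x → c * f x) ≡⟨ sumOver-*ˡ n c f ⟩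
    c * sumOver n f           ≡⟨ *-comm c _ ⟩
    sumOver n f * c           ∎
    where open ≡-Reasoning

  sumOver-const : ∀ n c → sumOver n (λ _ → c) ≡ 2 ^ n * c
  sumOver-const zero c = trans (+-identityʳ c) (sym (*-identityˡ c))
  sumOver-const (suc n) c = begin
    sumOver (suc n) (λ _ → c)              ≡⟨ sumOver-suc n _ ⟩
    sumOver n (λ _ → c) + sumOver n (λ _ → c) ≡⟨ cong₂ _+_ (sumOver-const n c) (sumOver-const n c) ⟩
    2 ^ n * c + 2 ^ n * c                  ≡⟨ double (2 ^ n) c ⟩
    2 * 2 ^ n * c                          ∎
    where
    open ≡-Reasoning
    double : ∀ x c → x * c + x * c ≡ 2 * x * c
    double = solve-∀

  sumOver-++ : ∀ m k (f : Vec Bool (m + k) → ℕ) →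
    sumOver (m + k) f ≡ sumOver m (λ u → sumOver k (λ w → f (u ++ w)))
  sumOver-++ zero k f = sym (+-identityʳ _)
  sumOver-++ (suc m) k f = begin
    sumOver (suc (m + k)) f
      ≡⟨ sumOver-suc (m + k) f ⟩
    sumOver (m + k) (f ∘ (true ∷_)) + sumOver (m + k) (f ∘ (false ∷_))
      ≡⟨ cong₂ _+_ (sumOver-++ m k (f ∘ (true ∷_))) (sumOver-++ m k (f ∘ (false ∷_))) ⟩
    sumOver m (λ u → sumOver k (λ w → f (true ∷ u ++ w)))
      + sumOver m (λ u → sumOver k (λ w → f (false ∷ u ++ w)))
      ≡⟨ sumOver-suc m _ ⟨
    sumOver (suc m) (λ u → sumOver k (λ w → f (u ++ w))) ∎
    where open ≡-Reasoning

  square-sum≤ : ∀ a b → (a + b) * (a + b) ≤ 2 * (a * a + b * b)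
  square-sum≤ a b = [ ordered , swapped ]′ (≤-total a b)
    where
    ordered : ∀ {a b} → a ≤ b → (a + b) * (a + b) ≤ 2 * (a * a + b * b)
    ordered {a} a≤b with d , refl ← m≤n⇒∃[o]m+o≡n a≤b =
      ≤-trans (m≤m+n _ (d * d)) (≤-reflexive (expand a d))
      where
      expand : ∀ a d → (a + (a + d)) * (a + (a + d)) + d * d ≡ 2 * (a * a + (a + d) * (a + d))
      expand = solve-∀
    swapped : b ≤ a → (a + b) * (a + b) ≤ 2 * (a * a + b * b)
    swapped b≤a = subst₂ _≤_ (cong (λ s → s * s) (+-comm b a)) (cong (2 *_) (+-comm (b * b) (a * a)))
                         (ordered b≤a)

  sumOver-Cauchy-Schwarz : ∀ m (f : Vec Bool m → ℕ) →
    sumOver m f * sumOver m f ≤ 2 ^ m * sumOver m (λ u → f u * f u)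
  sumOver-Cauchy-Schwarz zero f = ≤-reflexive (unit (f []))
    where
    unit : ∀ x → (x + 0) * (x + 0) ≡ 1 * (x * x + 0)
    unit = solve-∀
  sumOver-Cauchy-Schwarz (suc m) f = begin
    sumOver (suc m) f * sumOver (suc m) f ≡⟨ cong (λ s → s * s) (sumOver-suc m f) ⟩
    (A + B) * (A + B)                     ≤⟨ square-sum≤ A B ⟩
    2 * (A * A + B * B)                   ≤⟨ *-monoʳ-≤ 2 (+-mono-≤ (sumOver-Cauchy-Schwarz m (f ∘ (true ∷_)))
                                                                (sumOver-Cauchy-Schwarz m (f ∘ (false ∷_)))) ⟩
    2 * (2 ^ m * A² + 2 ^ m * B²)          ≡⟨ factor 2 (2 ^ m) A² B² ⟩
    2 * 2 ^ m * (A² + B²)                  ≡⟨ cong (2 ^ suc m *_) (sumOver-suc m _) ⟨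
    2 ^ suc m * sumOver (suc m) (λ u → f u * f u) ∎
    where
    open ≤-Reasoning
    A B A² B² : ℕ
    A = sumOver m (f ∘ (true ∷_))
    B = sumOver m (f ∘ (false ∷_))
    A² = sumOver m (λ u → f (true ∷ u) * f (true ∷ u))
    B² = sumOver m (λ u → f (false ∷ u) * f (false ∷ u))
    factor : ∀ x y a b → x * (y * a + y * b) ≡ x * y * (a + b)
    factor = solve-∀

module SignPatterns where

  open import Defs using (sign; S; mixS)
  open Binomial
  open Counting
  open import Data.Bool using (Bool; true; false)
  open import Data.Nat
  open import Data.Nat.Properties
  open import Data.Nat.Combinatorics using (_C_; nCk+nC[k+1]≡[n+1]C[k+1])
  open import Algebra.Properties.CommutativeSemigroup *-commutativeSemigroup using (x∙yz≈y∙xz)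
  open import Data.Integer as ℤ using (ℤ; +_; 0ℤ)
  import Data.Integer.Properties as ℤP
  open import Algebra.Properties.AbelianGroup ℤP.+-0-abelianGroup using (inverseʳ-unique; identityʳ-unique)
  open import Data.Nat.Tactic.RingSolver using (solve-∀)
  import Data.Integer.Tactic.RingSolver as ℤ-Solver
  open import Data.Vec using (Vec; []; _∷_; _++_)
  open import Relation.Binary.PropositionalEquality

  #true : ∀ {n} → Vec Bool n → ℕ
  #true []          = 0
  #true (true ∷ v)  = suc (#true v)
  #true (false ∷ v) = #true v

  n+S≡#true+#true : ∀ {n} (v : Vec Bool n) → + n ℤ.+ S v ≡ + (#true v + #true v)
  n+S≡#true+#true [] = refl
  n+S≡#true+#true {suc n} (true ∷ v) = begin
    + suc n ℤ.+ (+ 1 ℤ.+ S v)          ≡⟨ shift (+ n) (S v) ⟩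
    + 2 ℤ.+ (+ n ℤ.+ S v)              ≡⟨ cong (λ z → + 2 ℤ.+ z) (n+S≡#true+#true v) ⟩
    + (2 + (#true v + #true v))        ≡⟨ cong +_ (cong suc (+-suc (#true v) (#true v))) ⟨
    + (suc (#true v) + suc (#true v))  ∎
    where
    open ≡-Reasoning
    shift : ∀ x y → (+ 1 ℤ.+ x) ℤ.+ (+ 1 ℤ.+ y) ≡ + 2 ℤ.+ (x ℤ.+ y)
    shift = ℤ-Solver.solve-∀
  n+S≡#true+#true {suc n} (false ∷ v) = trans (cancel (+ n) (S v)) (n+S≡#true+#true v)
    where
    cancel : ∀ x y → (+ 1 ℤ.+ x) ℤ.+ (ℤ.- + 1 ℤ.+ y) ≡ x ℤ.+ y
    cancel = ℤ-Solver.solve-∀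

  count-#true : ∀ k r → sumOver k (λ w → 𝟙 (#true w ≟ r)) ≡ k C r
  count-#true zero zero = refl
  count-#true zero (suc r) = refl
  count-#true (suc k) zero = begin
    sumOver (suc k) (λ w → 𝟙 (#true w ≟ 0))                 ≡⟨ sumOver-suc k _ ⟩
    sumOver k (λ _ → 0) + sumOver k (λ w → 𝟙 (#true w ≟ 0)) ≡⟨ cong₂ _+_ (sumOver-const k 0) (count-#true k 0) ⟩
    2 ^ k * 0 + 1                                            ≡⟨ cong (_+ 1) (*-zeroʳ (2 ^ k)) ⟩
    1                                                        ∎
    where open ≡-Reasoning
  count-#true (suc k) (suc r) = begin
    sumOver (suc k) (λ w → 𝟙 (#true w ≟ suc r)) ≡⟨ sumOver-suc k _ ⟩
    sumOver k (λ w → 𝟙 (#true w ≟ r)) + sumOver k (λ w → 𝟙 (#true w ≟ suc r))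
                                                 ≡⟨ cong₂ _+_ (count-#true k r) (count-#true k (suc r)) ⟩
    k C r + k C suc r                            ≡⟨ nCk+nC[k+1]≡[n+1]C[k+1] k r ⟩
    suc k C suc r                                ∎
    where open ≡-Reasoning

  𝟙₀ : ℤ → ℕ
  𝟙₀ z = 𝟙 (z ℤ.≟ 0ℤ)

  completions : ℕ → ℤ → ℕ
  completions k c = sumOver k (λ w → 𝟙₀ (c ℤ.+ S w))

  completions≤maxBinomial : ∀ k c → completions k c ≤ maxBinomial k
  completions≤maxBinomial k c = begin
    completions k c                   ≤⟨ sumOver-mono k (λ w →
                                           𝟙-mono (c ℤ.+ S w ℤ.≟ 0ℤ) (#true w ≟ r) (#true-determined w)) ⟩
    sumOver k (λ w → 𝟙 (#true w ≟ r)) ≡⟨ count-#true k r ⟩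
    k C r                             ≤⟨ nCk≤maxBinomial k r ⟩
    maxBinomial k                     ∎
    where
    open ≤-Reasoning
    -- c + S w = 0 forces 2 · #true w = k + S w = k − c
    r : ℕ
    r = ⌊ ℤ.∣ + k ℤ.- c ∣ /2⌋
    #true-determined : ∀ w → c ℤ.+ S w ≡ 0ℤ → #true w ≡ r
    #true-determined w c+S≡0 = trans (n≡⌊n+n/2⌋ (#true w)) (cong (λ z → ⌊ ℤ.∣ z ∣ /2⌋) (sym k-c≡2t))
      where
      k-c≡2t : + k ℤ.- c ≡ + (#true w + #true w)
      k-c≡2t = trans (cong (λ z → + k ℤ.+ z) (sym (inverseʳ-unique c (S w) c+S≡0))) (n+S≡#true+#true w)

  S-++ : ∀ {m k} (u : Vec Bool m) (w : Vec Bool k) → S (u ++ w) ≡ S u ℤ.+ S w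
  S-++ []      w = sym (ℤP.+-identityˡ (S w))
  S-++ (b ∷ u) w = trans (cong (λ z → sign b ℤ.+ z) (S-++ u w)) (sym (ℤP.+-assoc (sign b) (S u) (S w)))

  mixS-zero : ∀ {k} (x x' : Vec Bool k) → mixS 0 x x' ≡ S x'
  mixS-zero []      []        = refl
  mixS-zero (_ ∷ x) (b' ∷ x') = cong (λ z → sign b' ℤ.+ z) (mixS-zero x x')

  mixS-++ : ∀ {m k} (u u' : Vec Bool m) (w w' : Vec Bool k) → mixS m (u ++ w) (u' ++ w') ≡ S u ℤ.+ S w'
  mixS-++ []      []       w w' = trans (mixS-zero w w') (sym (ℤP.+-identityˡ (S w')))
  mixS-++ (b ∷ u) (_ ∷ u') w w' =
    trans (cong (λ z → sign b ℤ.+ z) (mixS-++ u u' w w')) (sym (ℤP.+-assoc (sign b) (S u) (S w')))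

  balanced : ℕ → ℕ
  balanced n = sumOver n (λ x → 𝟙₀ (S x))

  jointlyBalanced : ℕ → ℕ → ℕ
  jointlyBalanced n m = sumOver n (λ x → sumOver n (λ x' → 𝟙₀ (S x) * 𝟙₀ (mixS m x x')))

  balanced-split : ∀ m k → balanced (m + k) ≡ sumOver m (λ u → completions k (S u))
  balanced-split m k = trans (sumOver-++ m k _)
    (sumOver-cong m (λ u → sumOver-cong k (λ w → cong 𝟙₀ (S-++ u w))))

  jointlyBalanced-split : ∀ m k →
    jointlyBalanced (m + k) m ≡ 2 ^ m * sumOver m (λ u → completions k (S u) * completions k (S u))
  jointlyBalanced-split m k = begin
    jointlyBalanced (m + k) m
      ≡⟨ sumOver-++ m k _ ⟩
    sumOver m (λ u → sumOver k (λ w → sumOver (m + k) (λ x' → 𝟙₀ (S (u ++ w)) * 𝟙₀ (mixS m (u ++ w) x'))))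
      ≡⟨ sumOver-cong m (λ u → sumOver-cong k (λ w → second-copy u w)) ⟩
    sumOver m (λ u → sumOver k (λ w → 𝟙₀ (S u ℤ.+ S w) * (2 ^ m * F u)))
      ≡⟨ sumOver-cong m (λ u → sumOver-*ʳ k (2 ^ m * F u) _) ⟩
    sumOver m (λ u → F u * (2 ^ m * F u))
      ≡⟨ sumOver-cong m (λ u → x∙yz≈y∙xz (F u) (2 ^ m) (F u)) ⟩
    sumOver m (λ u → 2 ^ m * (F u * F u))
      ≡⟨ sumOver-*ˡ m (2 ^ m) _ ⟩
    2 ^ m * sumOver m (λ u → F u * F u) ∎
    where
    open ≡-Reasoning
    F : Vec Bool m → ℕ
    F u = completions k (S u)
    second-copy : ∀ u w → sumOver (m + k) (λ x' → 𝟙₀ (S (u ++ w)) * 𝟙₀ (mixS m (u ++ w) x'))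
                        ≡ 𝟙₀ (S u ℤ.+ S w) * (2 ^ m * F u)
    second-copy u w = begin
      sumOver (m + k) (λ x' → 𝟙₀ (S (u ++ w)) * 𝟙₀ (mixS m (u ++ w) x'))
        ≡⟨ sumOver-*ˡ (m + k) (𝟙₀ (S (u ++ w))) (λ x' → 𝟙₀ (mixS m (u ++ w) x')) ⟩
      𝟙₀ (S (u ++ w)) * sumOver (m + k) (λ x' → 𝟙₀ (mixS m (u ++ w) x'))
        ≡⟨ cong₂ _*_ (cong 𝟙₀ (S-++ u w)) (sumOver-++ m k _) ⟩
      𝟙₀ (S u ℤ.+ S w) * sumOver m (λ u' → sumOver k (λ w' → 𝟙₀ (mixS m (u ++ w) (u' ++ w'))))
        ≡⟨ cong (𝟙₀ (S u ℤ.+ S w) *_)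
                (sumOver-cong m (λ u' → sumOver-cong k (λ w' → cong 𝟙₀ (mixS-++ u u' w w')))) ⟩
      𝟙₀ (S u ℤ.+ S w) * sumOver m (λ _ → F u)
        ≡⟨ cong (𝟙₀ (S u ℤ.+ S w) *_) (sumOver-const m (F u)) ⟩
      𝟙₀ (S u ℤ.+ S w) * (2 ^ m * F u) ∎

  balanced-even : ∀ N → balanced (N + N) ≡ (N + N) C N
  balanced-even N = trans
    (sumOver-cong (N + N) (λ x → 𝟙-cong (S x ℤ.≟ 0ℤ) (#true x ≟ N) (S≡0⇒#true≡N x) (#true≡N⇒S≡0 x)))
    (count-#true (N + N) N)
    where
    S≡0⇒#true≡N : ∀ x → S x ≡ 0ℤ → #true x ≡ N
    S≡0⇒#true≡N x S≡0 = sym (trans (n≡⌊n+n/2⌋ N) (trans (cong ⌊_/2⌋ 2N≡2t) (sym (n≡⌊n+n/2⌋ (#true x)))))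
      where
      2N≡2t : N + N ≡ #true x + #true x
      2N≡2t = ℤP.+-injective (trans (sym (ℤP.+-identityʳ (+ (N + N))))
                (trans (cong (λ z → + (N + N) ℤ.+ z) (sym S≡0)) (n+S≡#true+#true x)))
    #true≡N⇒S≡0 : ∀ x → #true x ≡ N → S x ≡ 0ℤ
    #true≡N⇒S≡0 x t≡N = identityʳ-unique (+ (N + N)) (S x) (trans (n+S≡#true+#true x) (cong (λ t → + (t + t)) t≡N))

  balanced²≤jointlyBalanced : ∀ m k → balanced (m + k) * balanced (m + k) ≤ jointlyBalanced (m + k) m
  balanced²≤jointlyBalanced m k = begin
    balanced (m + k) * balanced (m + k)
      ≡⟨ cong (λ X → X * X) (balanced-split m k) ⟩
    sumOver m (λ u → completions k (S u)) * sumOver m (λ u → completions k (S u))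
      ≤⟨ sumOver-Cauchy-Schwarz m (λ u → completions k (S u)) ⟩
    2 ^ m * sumOver m (λ u → completions k (S u) * completions k (S u))
      ≡⟨ jointlyBalanced-split m k ⟨
    jointlyBalanced (m + k) m ∎
    where open ≤-Reasoning

  jointlyBalanced≤ : ∀ m k →
    k * jointlyBalanced (m + k) m ≤ (m + k) * maxBinomial (m + k) * balanced (m + k)
  jointlyBalanced≤ m k = begin
    k * jointlyBalanced (m + k) m
      ≡⟨ cong (k *_) (jointlyBalanced-split m k) ⟩
    k * (2 ^ m * sumOver m (λ u → F u * F u))
      ≤⟨ *-monoʳ-≤ k (*-monoʳ-≤ (2 ^ m)
           (sumOver-mono m (λ u → *-monoˡ-≤ (F u) (completions≤maxBinomial k (S u))))) ⟩
    k * (2 ^ m * sumOver m (λ u → maxBinomial k * F u))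
      ≡⟨ cong (λ s → k * (2 ^ m * s)) (sumOver-*ˡ m (maxBinomial k) F) ⟩
    k * (2 ^ m * (maxBinomial k * sumOver m F))
      ≡⟨ regroup k (2 ^ m) (maxBinomial k) (sumOver m F) ⟩
    2 ^ m * (k * maxBinomial k) * sumOver m F
      ≤⟨ *-monoˡ-≤ (sumOver m F) (maxBinomial-growth-+ m k) ⟩
    (m + k) * maxBinomial (m + k) * sumOver m F
      ≡⟨ cong ((m + k) * maxBinomial (m + k) *_) (balanced-split m k) ⟨
    (m + k) * maxBinomial (m + k) * balanced (m + k) ∎
    where
    open ≤-Reasoning
    F : Vec Bool m → ℕ
    F u = completions k (S u)
    regroup : ∀ k p M s → k * (p * (M * s)) ≡ p * (k * M) * s
    regroup = solve-∀

  even⇒maxBinomial≡balanced : ∀ {n N} → n ≡ N + N → maxBinomial n ≡ balanced n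
  even⇒maxBinomial≡balanced {N = N} refl = trans (maxBinomial-even N) (sym (balanced-even N))

  even⇒0<balanced : ∀ {n N} → n ≡ N + N → 0 < balanced n
  even⇒0<balanced {N = N} refl = subst (0 <_) (sym (balanced-even N)) (k≤n⇒0<nCk (m≤m+n N N))

  even⇒jointlyBalanced≤ : ∀ {m k N} → m + k ≡ N + N →
    k * jointlyBalanced (m + k) m ≤ (m + k) * (balanced (m + k) * balanced (m + k))
  even⇒jointlyBalanced≤ {m} {k} {N} m+k≡2N = begin
    k * jointlyBalanced (m + k) m                    ≤⟨ jointlyBalanced≤ m k ⟩
    (m + k) * maxBinomial (m + k) * balanced (m + k) ≡⟨ cong (λ M → (m + k) * M * balanced (m + k))
                                                              (even⇒maxBinomial≡balanced {N = N} m+k≡2N) ⟩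
    (m + k) * balanced (m + k) * balanced (m + k)    ≡⟨ *-assoc (m + k) _ _ ⟩
    (m + k) * (balanced (m + k) * balanced (m + k))  ∎
    where open ≤-Reasoning

module RationalFacts where

  open import Defs using (toℚ; halfPow)
  open import Data.Nat as ℕ using (ℕ; zero; suc)
  open import Data.Integer as ℤ using (+_; +≤+; +<+)
  import Data.Integer.Properties as ℤP
  open import Data.Rational
    using ( ℚ; mkℚ; 0ℚ; 1ℚ; _+_; _*_; _-_; -_; _/_; _÷_; 1/_; _≤_; _<_; ∣_∣; NonZero
          ; *≤*; *<*; positive; nonNegative)
  open import Data.Rational.Properties
  open import Data.Rational.Solver using (module +-*-Solver)
  open import Data.Nat.Coprimality using (1-coprimeTo) renaming (sym to coprime-sym)
  open import Relation.Binary.PropositionalEquality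

  toℚ≡mkℚ : ∀ n → toℚ n ≡ mkℚ (+ n) 0 (coprime-sym (1-coprimeTo n))
  toℚ≡mkℚ n = normalize-coprime (coprime-sym (1-coprimeTo n))

  toℚ-+ : ∀ a b → toℚ (a ℕ.+ b) ≡ toℚ a + toℚ b
  toℚ-+ a b rewrite toℚ≡mkℚ a | toℚ≡mkℚ b = cong (_/ 1) (trans (ℤP.pos-+ a b)
    (sym (cong₂ ℤ._+_ (ℤP.*-identityʳ (+ a)) (ℤP.*-identityʳ (+ b)))))

  toℚ-* : ∀ a b → toℚ (a ℕ.* b) ≡ toℚ a * toℚ b
  toℚ-* a b rewrite toℚ≡mkℚ a | toℚ≡mkℚ b = cong (_/ 1) (ℤP.pos-* a b)

  toℚ-mono-≤ : ∀ {a b} → a ℕ.≤ b → toℚ a ≤ toℚ b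
  toℚ-mono-≤ {a} {b} a≤b rewrite toℚ≡mkℚ a | toℚ≡mkℚ b =
    *≤* (subst₂ ℤ._≤_ (sym (ℤP.*-identityʳ (+ a))) (sym (ℤP.*-identityʳ (+ b))) (+≤+ a≤b))

  toℚ-cancel-≤ : ∀ {a b} → toℚ a ≤ toℚ b → a ℕ.≤ b
  toℚ-cancel-≤ {a} {b} le rewrite toℚ≡mkℚ a | toℚ≡mkℚ b with le
  ... | *≤* a*1≤b*1 =
    ℤ.drop‿+≤+ (subst₂ ℤ._≤_ (ℤP.*-identityʳ (+ a)) (ℤP.*-identityʳ (+ b)) a*1≤b*1)

  0<toℚ : ∀ {a} → 0 ℕ.< a → 0ℚ < toℚ a
  0<toℚ 0<a = <-≤-trans (*<* (+<+ (ℕ.s≤s ℕ.z≤n))) (toℚ-mono-≤ 0<a)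

  halfPow-+ : ∀ a b → halfPow (a ℕ.+ b) ≡ halfPow a * halfPow b
  halfPow-+ zero    b = sym (*-identityˡ (halfPow b))
  halfPow-+ (suc a) b = trans (cong (+ 1 / 2 *_) (halfPow-+ a b)) (sym (*-assoc (+ 1 / 2) (halfPow a) (halfPow b)))

  halfPow-pos : ∀ a → 0ℚ < halfPow a
  halfPow-pos zero    = *<* (+<+ (ℕ.s≤s ℕ.z≤n))
  halfPow-pos (suc a) = subst (_< + 1 / 2 * halfPow a) (*-zeroʳ (+ 1 / 2)) (*-monoʳ-<-pos (+ 1 / 2) (halfPow-pos a))

  0<*0< : ∀ {p q} → 0ℚ < p → 0ℚ < q → 0ℚ < p * q
  0<*0< {p} {q} 0<p 0<q = positive⁻¹ (p * q) {{pos*pos⇒pos p {{positive 0<p}} q {{positive 0<q}}}}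

  0≤*0≤ : ∀ {p q} → 0ℚ ≤ p → 0ℚ ≤ q → 0ℚ ≤ p * q
  0≤*0≤ {p} {q} 0≤p 0≤q =
    nonNegative⁻¹ (p * q) {{nonNeg*nonNeg⇒nonNeg p {{nonNegative 0≤p}} q {{nonNegative 0≤q}}}}

  0≤+0≤ : ∀ {p q} → 0ℚ ≤ p → 0ℚ ≤ q → 0ℚ ≤ p + q
  0≤+0≤ {p} {q} 0≤p 0≤q = subst (_≤ p + q) (+-identityʳ 0ℚ) (+-mono-≤ 0≤p 0≤q)

  p≤q⇒0≤q-p : ∀ {p q} → p ≤ q → 0ℚ ≤ q - p
  p≤q⇒0≤q-p {p} {q} p≤q = subst (_≤ q - p) (+-inverseʳ p) (+-monoˡ-≤ (- p) p≤q)

  0≤q-p⇒p≤q : ∀ {p q} → 0ℚ ≤ q - p → p ≤ q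
  0≤q-p⇒p≤q {p} {q} 0≤q-p = subst₂ _≤_ (+-identityʳ p) (p+[q-p]≡q p q) (+-monoʳ-≤ p 0≤q-p)
    where
    open +-*-Solver
    p+[q-p]≡q : ∀ p q → p + (q - p) ≡ q
    p+[q-p]≡q = solve 2 (λ p q → p :+ (q :- p) := q) refl

  [1-ε]*q≤q : ∀ {ε q} → 0ℚ ≤ ε → 0ℚ ≤ q → (1ℚ - ε) * q ≤ q
  [1-ε]*q≤q {ε} {q} 0≤ε 0≤q = 0≤q-p⇒p≤q (subst (0ℚ ≤_) (sym (difference ε q)) (0≤*0≤ 0≤ε 0≤q))
    where
    open +-*-Solver
    difference : ∀ ε q → q - (1ℚ - ε) * q ≡ ε * q
    difference = solve 2 (λ ε q → q :- (con 1ℚ :- ε) :* q := ε :* q) refl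

  ≤[1-ε]*⇒≤ : ∀ {ε m n} → 0ℚ < ε → toℚ m ≤ (1ℚ - ε) * toℚ n → m ℕ.≤ n
  ≤[1-ε]*⇒≤ {n = n} 0<ε m≤[1-ε]n =
    toℚ-cancel-≤ (≤-trans m≤[1-ε]n ([1-ε]*q≤q (<⇒≤ 0<ε) (toℚ-mono-≤ {0} {n} ℕ.z≤n)))

  ÷-*-cancel : ∀ p q .{{_ : NonZero q}} → (p ÷ q) * q ≡ p
  ÷-*-cancel p q = trans (*-assoc p (1/ q) q) (trans (cong (p *_) (*-inverseˡ q)) (*-identityʳ p))

  *-cancelʳ-≡-pos : ∀ {p q r} → 0ℚ < r → p * r ≡ q * r → p ≡ q
  *-cancelʳ-≡-pos {r = r} 0<r pr≡qr = ≤-antisym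
    (*-cancelʳ-≤-pos r {{positive 0<r}} (≤-reflexive pr≡qr))
    (*-cancelʳ-≤-pos r {{positive 0<r}} (≤-reflexive (sym pr≡qr)))

  ratio≥1 : ∀ {a U v} → 0ℚ < U → a * U ≡ v → U ≤ v → 1ℚ ≤ a
  ratio≥1 {a} {U} 0<U aU≡v U≤v =
    *-cancelʳ-≤-pos U {{positive 0<U}} (subst₂ _≤_ (sym (*-identityˡ U)) (sym aU≡v) U≤v)

  ratio≤ : ∀ {a U v b c} → 0ℚ < U → a * U ≡ v → b * v ≤ c * U → b * a ≤ c
  ratio≤ {a} {U} {v} {b} {c} 0<U aU≡v bv≤cU =
    *-cancelʳ-≤-pos U {{positive 0<U}}
      (subst (_≤ c * U) (trans (cong (b *_) (sym aU≡v)) (sym (*-assoc b a U))) bv≤cU)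

  deviation-bound : ∀ {a ε m k} → 1ℚ ≤ a → k * a ≤ m + k → m ≤ (1ℚ - ε) * (m + k) →
                    ∣ a - 1ℚ ∣ * ε * (m + k) ≤ m
  deviation-bound {a} {ε} {m} {k} 1≤a ka≤m+k m≤[1-ε][m+k] =
    subst (λ d → d * ε * (m + k) ≤ m) (sym (0≤p⇒∣p∣≡p 0≤a-1))
      (0≤q-p⇒p≤q (subst (0ℚ ≤_) (sym (slack a ε m k))
        (0≤+0≤ (p≤q⇒0≤q-p ka≤m+k) (0≤*0≤ 0≤a-1 (p≤q⇒0≤q-p m≤[1-ε][m+k])))))
    where
    open +-*-Solver
    0≤a-1 : 0ℚ ≤ a - 1ℚ
    0≤a-1 = p≤q⇒0≤q-p 1≤a
    -- the slack in the bound is a sum of the slacks in the two hypotheses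
    slack : ∀ a ε m k → m - (a - 1ℚ) * ε * (m + k) ≡ ((m + k) - k * a) + (a - 1ℚ) * ((1ℚ - ε) * (m + k) - m)
    slack = solve 4 (λ a ε m k → m :- (a :- con 1ℚ) :* ε :* (m :+ k)
                                 := ((m :+ k) :- k :* a) :+ (a :- con 1ℚ) :* ((con 1ℚ :- ε) :* (m :+ k) :- m)) refl

module Probabilities where

  open import Defs
  open Counting
  open SignPatterns
  open RationalFacts
  open import Data.Nat as ℕ using (ℕ)
  import Data.Nat.Properties as ℕ
  import Data.Integer as ℤ
  open import Data.Rational as ℚ using (ℚ; 0ℚ; 1ℚ; _*_; _<_; ∣_∣)
  open import Data.Rational.Properties using (*-assoc; <-irrefl)
  open import Data.Rational.Solver using (module +-*-Solver)
  open import Data.List using (length; filter; cartesianProduct)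
  open import Relation.Unary using (Decidable)
  open import Function using (_∘_)
  open import Data.Product using (_,_)
  open import Relation.Nullary.Decidable using (dec-no)
  open import Relation.Binary.PropositionalEquality

  P₁≡ : ∀ n → P₁ n ≡ toℚ (balanced n) * halfPow n
  P₁≡ n = cong (λ c → toℚ c * halfPow n) (length-filter≡sum-𝟙 (λ v → S v ℤ.≟ ℤ.+ 0) (allVec n))

  count-jointEvent : ∀ n m (E? : Decidable (jointEvent {n} m)) →
    length (filter E? (cartesianProduct (allVec n) (allVec n))) ≡ jointlyBalanced n m
  count-jointEvent n m E? =
    trans (length-filter≡sum-𝟙 E? (cartesianProduct (allVec n) (allVec n)))
      (trans (sum-map-cartesianProduct (𝟙 ∘ E?) (allVec n) (allVec n))
        (sumOver-cong n (λ x → sumOver-cong n (λ x' →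
          𝟙-× (S x ℤ.≟ ℤ.+ 0) (mixS m x x' ℤ.≟ ℤ.+ 0) (E? (x , x'))))))

  P₂≡ : ∀ n m → P₂ n m ≡ toℚ (jointlyBalanced n m) * (halfPow n * halfPow n)
  P₂≡ n m = cong₂ (λ c h → toℚ c * h) (count-jointEvent n m _) (halfPow-+ n n)

  α*P₁²≡P₂ : ∀ n m → P₁ n * P₁ n ≢ 0ℚ → α n m * (P₁ n * P₁ n) ≡ P₂ n m
  α*P₁²≡P₂ n m D≢0 rewrite dec-no (P₁ n * P₁ n ℚ.≟ 0ℚ) D≢0 =
    ÷-*-cancel (P₂ n m) (P₁ n * P₁ n) {{ℚ.≢-nonZero D≢0}}

  α*balanced²≡jointlyBalanced : ∀ n m → 0 ℕ.< balanced n →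
    α n m * (toℚ (balanced n) * toℚ (balanced n)) ≡ toℚ (jointlyBalanced n m)
  α*balanced²≡jointlyBalanced n m 0<X = *-cancelʳ-≡-pos 0<w (begin
    α n m * U * w   ≡⟨ *-assoc (α n m) U w ⟩
    α n m * (U * w) ≡⟨ cong (α n m *_) D≡Uw ⟨
    α n m * D       ≡⟨ α*P₁²≡P₂ n m D≢0 ⟩
    P₂ n m          ≡⟨ P₂≡ n m ⟩
    toℚ (jointlyBalanced n m) * w ∎)
    where
    open ≡-Reasoning
    X U w D : ℚ
    X = toℚ (balanced n)
    U = X * X
    w = halfPow n * halfPow n
    D = P₁ n * P₁ n
    0<w : 0ℚ < w
    0<w = 0<*0< (halfPow-pos n) (halfPow-pos n)
    D≡Uw : D ≡ U * w
    D≡Uw = trans (cong₂ _*_ (P₁≡ n) (P₁≡ n)) (regroup X (halfPow n))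
      where
      open +-*-Solver
      regroup : ∀ x h → (x * h) * (x * h) ≡ (x * x) * (h * h)
      regroup = solve 2 (λ x h → (x :* h) :* (x :* h) := (x :* x) :* (h :* h)) refl
    D≢0 : D ≢ 0ℚ
    D≢0 D≡0 = <-irrefl refl (subst (0ℚ <_) (trans (sym D≡Uw) D≡0) (0<*0< (0<*0< (0<toℚ 0<X) (0<toℚ 0<X)) 0<w))

  module _ {m k N : ℕ} (m+k≡2N : m ℕ.+ k ≡ N ℕ.+ N) where

    private
      X : ℕ
      X = balanced (m ℕ.+ k)
      0<X : 0 ℕ.< X
      0<X = even⇒0<balanced {N = N} m+k≡2N
      0<U : 0ℚ < toℚ X * toℚ X
      0<U = 0<*0< (0<toℚ {X} 0<X) (0<toℚ {X} 0<X)

    1≤α : 1ℚ ℚ.≤ α (m ℕ.+ k) m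
    1≤α = ratio≥1 0<U (α*balanced²≡jointlyBalanced (m ℕ.+ k) m 0<X)
      (subst (ℚ._≤ toℚ (jointlyBalanced (m ℕ.+ k) m)) (toℚ-* X X)
        (toℚ-mono-≤ {X ℕ.* X} {jointlyBalanced (m ℕ.+ k) m} (balanced²≤jointlyBalanced m k)))

    kα≤m+k : toℚ k * α (m ℕ.+ k) m ℚ.≤ toℚ m ℚ.+ toℚ k
    kα≤m+k = ratio≤ {b = toℚ k} 0<U (α*balanced²≡jointlyBalanced (m ℕ.+ k) m 0<X)
      (subst₂ ℚ._≤_ (toℚ-* k (jointlyBalanced (m ℕ.+ k) m))
                    (trans (toℚ-* (m ℕ.+ k) (X ℕ.* X)) (cong₂ _*_ (toℚ-+ m k) (toℚ-* X X)))
        (toℚ-mono-≤ {k ℕ.* jointlyBalanced (m ℕ.+ k) m} {(m ℕ.+ k) ℕ.* (X ℕ.* X)}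
                    (even⇒jointlyBalanced≤ {m} {k} {N} m+k≡2N)))

  α-deviation-m+k : ∀ {ε m k N} → m ℕ.+ k ≡ N ℕ.+ N → toℚ m ℚ.≤ (1ℚ ℚ.- ε) * toℚ (m ℕ.+ k) →
    ∣ α (m ℕ.+ k) m ℚ.- 1ℚ ∣ * ε * toℚ (m ℕ.+ k) ℚ.≤ toℚ m
  α-deviation-m+k {ε} {m} {k} {N} m+k≡2N m≤[1-ε][m+k] =
    subst (λ q → ∣ α (m ℕ.+ k) m ℚ.- 1ℚ ∣ * ε * q ℚ.≤ toℚ m) (sym (toℚ-+ m k))
      (deviation-bound {α (m ℕ.+ k) m} {ε} {toℚ m} {toℚ k}
        (1≤α {m} {k} {N} m+k≡2N) (kα≤m+k {m} {k} {N} m+k≡2N)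
        (subst (λ q → toℚ m ℚ.≤ (1ℚ ℚ.- ε) * q) (toℚ-+ m k) m≤[1-ε][m+k]))

  α-deviation : ∀ {ε n m N} → 0ℚ < ε → n ≡ N ℕ.+ N → toℚ m ℚ.≤ (1ℚ ℚ.- ε) * toℚ n →
                ∣ α n m ℚ.- 1ℚ ∣ * ε * toℚ n ℚ.≤ toℚ m
  α-deviation {ε} {n} {m} {N} 0<ε n≡2N m≤[1-ε]n =
    subst (λ j → ∣ α j m ℚ.- 1ℚ ∣ * ε * toℚ j ℚ.≤ toℚ m) m+k≡n
      (α-deviation-m+k {ε} {m} {n ℕ.∸ m} {N} (trans m+k≡n n≡2N)
        (subst (λ j → toℚ m ℚ.≤ (1ℚ ℚ.- ε) * toℚ j) (sym m+k≡n) m≤[1-ε]n))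
    where
    m+k≡n : m ℕ.+ (n ℕ.∸ m) ≡ n
    m+k≡n = ℕ.m+[n∸m]≡n (≤[1-ε]*⇒≤ {ε} {m} {n} 0<ε m≤[1-ε]n)

open import Defs
open import Data.Nat using (ℕ)
open import Data.Product using (Σ; ∃; _,_)
open import Data.Rational using (ℚ; 0ℚ; 1ℚ; _<_; _≤_; _+_; _-_; _*_; ∣_∣)
open import Relation.Binary.PropositionalEquality using (_≡_; cong; trans; sym; subst)
open import Data.Nat.Properties using (+-identityʳ)
open import Data.Rational.Properties using (*-identityˡ)
open Probabilities using (α-deviation)

lemma4p1 : Σ ℚ λ C → ∀ (ε : ℚ) → 0ℚ < ε → ε < 1ℚ →
    ∀ (n m : ℕ) → (∃ λ k → n ≡ 2 Data.Nat.* k) → toℚ m ≤ (1ℚ - ε) * toℚ n →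
    ∣ α n m - 1ℚ ∣ * ε * toℚ n ≤ C * toℚ m
lemma4p1 = 1ℚ , λ ε 0<ε _ n m (N , n≡2N) m≤[1-ε]n →
  subst (∣ α n m - 1ℚ ∣ * ε * toℚ n ≤_) (sym (*-identityˡ (toℚ m)))
    (α-deviation {ε} {n} {m} {N} 0<ε (trans n≡2N (cong (N Data.Nat.+_) (+-identityʳ N))) m≤[1-ε]n)
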